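{- Let $n=p_1^{n_1}\cdots p_r^{n_r}$ with $r\geq 3$, primes $p_1<\cdots<p_r$ and positive integers $n_i$. Then $\beta_1^1>\beta_2^1>\cdots>\beta_r^1$.
   Context: $\phi$ is Euler's totient function. For $a\in\{1,\dots,r\}$ and $1\le s\le n_a$, $$\beta_a^s:=\phi(n)+\frac{n}{p_1\cdots p_r}\cdot\frac{1}{p_a^{s-1}}\left[\frac{p_1\cdots p_r}{p_a}+\phi\left(\frac{p_1\cdots p_r}{p_a}\right)(p_a^{s-1}-2)\right];$$ in particular $\beta_a^1=\phi(n)+\frac{n}{p_1\cdots p_r}\left[\frac{p_1\cdots p_r}{p_a}-\phi\left(\frac{p_1\cdots p_r}{p_a}\right)\right]$. -}

module Defs where

open import Data.Nat using (ℕ; zero; suc; _+_; _*_; _∸_; _^_)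
open import Data.Nat.GCD using (gcd)
open import Data.Fin using (Fin; zero; suc)
open import Data.Fin.Properties using () renaming (_≟_ to _≟ᶠ_)
open import Data.Bool using (if_then_else_)
open import Relation.Nullary using (does)
import Data.Nat as ℕ

coprimeCount : ℕ → ℕ → ℕ
coprimeCount zero    m = 0
coprimeCount (suc k) m =
  (if does (gcd (suc k) m ℕ.≟ 1) then 1 else 0) + coprimeCount k m

φ : ℕ → ℕ
φ m = coprimeCount m m

∏ : ∀ {r} → (Fin r → ℕ) → ℕ
∏ {zero}  f = 1
∏ {suc r} f = f zero * ∏ (λ i → f (suc i))

nOf : ∀ {r} → (Fin r → ℕ) → (Fin r → ℕ) → ℕ
nOf p e = ∏ (λ i → p i ^ e i)

-- p_1 ⋯ p_r / p_a  (computed as the product over i ≠ a)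
radExcept : ∀ {r} → (Fin r → ℕ) → Fin r → ℕ
radExcept p a = ∏ (λ i → if does (i ≟ᶠ a) then 1 else p i)

-- n / (p_1 ⋯ p_r)  (computed as ∏ p_i ^ (n_i - 1); exact since n_i ≥ 1)
nOverRad : ∀ {r} → (Fin r → ℕ) → (Fin r → ℕ) → ℕ
nOverRad p e = ∏ (λ i → p i ^ (e i ∸ 1))

-- β_a^1 = φ(n) + n/(p_1⋯p_r) · [ (p_1⋯p_r)/p_a − φ((p_1⋯p_r)/p_a) ]
-- (the bracket is ≥ 0 since φ(m) ≤ m, so truncated subtraction is exact)
β¹ : ∀ {r} → (Fin r → ℕ) → (Fin r → ℕ) → Fin r → ℕ
β¹ p e a = φ (nOf p e) + nOverRad p e * (radExcept p a ∸ φ (radExcept p a))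

-- With p = p_a < q = p_b and Q the product of the other primes,
-- p_1⋯p_r/p_a = q Q and p_1⋯p_r/p_b = p Q. For a prime p ∤ Q one has
-- φ(p Q) = (p − 1) φ(Q), hence  p Q − φ(p Q) = p (Q − φ Q) + φ Q.
-- Since r ≥ 3 gives Q ≥ 2, Q − φ Q is positive, so this cototient is strictly
-- increasing in p, and β_a^1 − β_b^1 = n/(p_1⋯p_r) · (q − p)(Q − φ Q) > 0.
module Submission where

open import Defs
open import Data.Bool using (Bool; true; false; _∧_; not; if_then_else_)
open import Data.Empty using (⊥-elim)
open import Data.Fin using (Fin; toℕ) renaming (zero to fzero; suc to fsuc)
open import Data.Fin.Properties using (toℕ-injective) renaming (_≟_ to _≟ᶠ_)
open import Data.Nat using (ℕ; zero; suc; _+_; _*_; _∸_; _≤_; _<_; z≤n; s≤s; NonZero; >-nonZero; nonTrivial⇒n>1)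
open import Data.Nat.Coprimality using (Coprime; coprime?; coprime-+; coprime-divisor)
open import Data.Nat.Divisibility
open import Data.Nat.Primality using (Prime; prime⇒nonZero; prime⇒nonTrivial; prime⇒irreducible; euclidsLemma; ¬prime[1])
open import Data.Nat.Properties
open import Data.Nat.Tactic.RingSolver using (solve-∀)
open import Data.Product using (Σ; _×_; _,_)
open import Data.Sum using (inj₁; inj₂)
open import Function.Bundles using (mk⇔)
open import Function.Definitions using (Injective)
open import Relation.Binary.Definitions using (tri<; tri≈; tri>)
open import Relation.Binary.PropositionalEquality
  using (_≡_; _≢_; refl; sym; trans; cong; cong₂; subst; subst₂; module ≡-Reasoning)
open import Relation.Nullary using (does; yes; no; ¬_)
open import Relation.Nullary.Decidable using (dec-true; dec-false; does-⇔)

count : (ℕ → Bool) → ℕ → ℕ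
count P zero    = 0
count P (suc k) = (if P (suc k) then 1 else 0) + count P k

count-cong : ∀ {P R : ℕ → Bool} → (∀ j → P j ≡ R j) → ∀ k → count P k ≡ count R k
count-cong P≗R zero    = refl
count-cong P≗R (suc k) =
  cong₂ (λ b c → (if b then 1 else 0) + c) (P≗R (suc k)) (count-cong P≗R k)

count≤ : ∀ P k → count P k ≤ k
count≤ P zero = z≤n
count≤ P (suc k) with P (suc k)
... | true  = s≤s (count≤ P k)
... | false = m≤n⇒m≤1+n (count≤ P k)

count< : ∀ P k → P (suc k) ≡ false → count P (suc k) < suc k
count< P k Pk≡false rewrite Pk≡false = s≤s (count≤ P k)

count-split : ∀ (D P : ℕ → Bool) k →
  count P k ≡ count (λ j → D j ∧ P j) k + count (λ j → not (D j) ∧ P j) k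
count-split D P zero = refl
count-split D P (suc k) with P (suc k) | D (suc k)
... | true  | true  = cong suc (count-split D P k)
... | true  | false = trans (cong suc (count-split D P k)) (sym (+-suc _ _))
... | false | true  = count-split D P k
... | false | false = count-split D P k

count-+-periodic : ∀ P m → (∀ j → P (m + j) ≡ P j) → ∀ k → count P (m + k) ≡ count P m + count P k
count-+-periodic P m periodic zero = trans (cong (count P) (+-identityʳ m)) (sym (+-identityʳ _))
count-+-periodic P m periodic (suc k) = begin
  count P (m + suc k)                               ≡⟨ cong (count P) (+-suc m k) ⟩
  χ (P (suc (m + k))) + count P (m + k)             ≡⟨ cong₂ _+_ (cong χ Psuc) (count-+-periodic P m periodic k) ⟩
  χ (P (suc k)) + (count P m + count P k)           ≡⟨ x+[y+z]≡y+[x+z] (χ (P (suc k))) (count P m) (count P k) ⟩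
  count P m + (χ (P (suc k)) + count P k)           ∎
  where
  open ≡-Reasoning
  χ : Bool → ℕ
  χ b = if b then 1 else 0
  Psuc : P (suc (m + k)) ≡ P (suc k)
  Psuc = trans (cong P (sym (+-suc m k))) (periodic (suc k))
  x+[y+z]≡y+[x+z] : ∀ x y z → x + (y + z) ≡ y + (x + z)
  x+[y+z]≡y+[x+z] = solve-∀

count-*-periodic : ∀ P m → (∀ j → P (m + j) ≡ P j) → ∀ t → count P (t * m) ≡ t * count P m
count-*-periodic P m periodic zero    = refl
count-*-periodic P m periodic (suc t) =
  trans (count-+-periodic P m periodic (t * m)) (cong (count P m +_) (count-*-periodic P m periodic t))

count-gap : ∀ P m i → (∀ j → j < i → P (suc (m + j)) ≡ false) → count P (m + i) ≡ count P m
count-gap P m zero    none = cong (count P) (+-identityʳ m)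
count-gap P m (suc i) none = begin
  count P (m + suc i)                                  ≡⟨ cong (count P) (+-suc m i) ⟩
  (if P (suc (m + i)) then 1 else 0) + count P (m + i) ≡⟨ cong (λ b → (if b then 1 else 0) + count P (m + i)) (none i ≤-refl) ⟩
  count P (m + i)                                      ≡⟨ count-gap P m i (λ j j<i → none j (m<n⇒m<1+n j<i)) ⟩
  count P m                                            ∎
  where open ≡-Reasoning

count-multiples : ∀ d .{{_ : NonZero d}} (P : ℕ → Bool) n →
  count (λ k → does (d ∣? k) ∧ P k) (d * n) ≡ count (λ j → P (d * j)) n
count-multiples d P zero = cong (count (λ k → does (d ∣? k) ∧ P k)) (*-zeroʳ d)
count-multiples d@(suc d′) P (suc n) = begin
  count R (d * suc n)                                    ≡⟨ cong (count R) (d*[1+n]≡1+[d*n+d′] d′ n) ⟩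
  (if R (suc (d * n + d′)) then 1 else 0) + count R (d * n + d′)
    ≡⟨ cong₂ _+_ last (count-gap R (d * n) d′ no-multiple) ⟩
  (if P (d * suc n) then 1 else 0) + count R (d * n)     ≡⟨ cong ((if P (d * suc n) then 1 else 0) +_) (count-multiples d P n) ⟩
  (if P (d * suc n) then 1 else 0) + count (λ j → P (d * j)) n ∎
  where
  open ≡-Reasoning
  R : ℕ → Bool
  R k = does (d ∣? k) ∧ P k
  d*[1+n]≡1+[d*n+d′] : ∀ d′ n → suc d′ * suc n ≡ suc (suc d′ * n + d′)
  d*[1+n]≡1+[d*n+d′] = solve-∀
  last : (if R (suc (d * n + d′)) then 1 else 0) ≡ (if P (d * suc n) then 1 else 0)
  last = trans (cong (λ k → if R k then 1 else 0) (sym (d*[1+n]≡1+[d*n+d′] d′ n)))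
               (cong (λ b → if b ∧ P (d * suc n) then 1 else 0) (dec-true (d ∣? d * suc n) (m∣m*n (suc n))))
  no-multiple : ∀ j → j < d′ → R (suc (d * n + j)) ≡ false
  no-multiple j j<d′ = cong (_∧ P (suc (d * n + j))) (dec-false (d ∣? suc (d * n + j)) d∤)
    where
    d∤ : d ∤ suc (d * n + j)
    d∤ d∣ = >⇒∤ (s≤s j<d′) (∣m+n∣m⇒∣n (subst (d ∣_) (sym (+-suc (d * n) j)) d∣) (m∣m*n n))

coprimeTo : ℕ → ℕ → Bool
coprimeTo m k = does (coprime? k m)

φ≡count : ∀ m → φ m ≡ count (coprimeTo m) m
φ≡count m = go m
  where
  go : ∀ k → coprimeCount k m ≡ count (coprimeTo m) k
  go zero    = refl
  go (suc k) = cong ((if coprimeTo m (suc k) then 1 else 0) +_) (go k)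

φ≤ : ∀ m → φ m ≤ m
φ≤ m = subst (_≤ m) (sym (φ≡count m)) (count≤ (coprimeTo m) m)

φ< : ∀ {m} → 2 ≤ m → φ m < m
φ< {suc k} 2≤m = subst (_< suc k) (sym (φ≡count (suc k)))
  (count< (coprimeTo (suc k)) k (dec-false (coprime? (suc k) (suc k)) ¬coprime))
  where
  ¬coprime : ¬ Coprime (suc k) (suc k)
  ¬coprime coprime with subst (2 ≤_) (coprime (∣-refl , ∣-refl)) 2≤m
  ... | s≤s ()

prime≢1 : ∀ {p} → Prime p → p ≢ 1
prime≢1 pr refl = ¬prime[1] pr

prime≥2 : ∀ {p} → Prime p → 2 ≤ p
prime≥2 {p} pr = nonTrivial⇒n>1 p {{prime⇒nonTrivial pr}}

prime∣prime⇒≡ : ∀ {p q} → Prime p → Prime q → p ∣ q → p ≡ q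
prime∣prime⇒≡ pp pq p∣q with prime⇒irreducible pq p∣q
... | inj₁ p≡1 = ⊥-elim (prime≢1 pp p≡1)
... | inj₂ p≡q = p≡q

∣∤prime⇒coprime : ∀ {p k i} → Prime p → p ∤ k → i ∣ k → Coprime i p
∣∤prime⇒coprime pr p∤k i∣k (j∣i , j∣p) with prime⇒irreducible pr j∣p
... | inj₁ j≡1 = j≡1
... | inj₂ refl = ⊥-elim (p∤k (∣-trans j∣i i∣k))

coprimeTo-periodic : ∀ Q j → coprimeTo Q (Q + j) ≡ coprimeTo Q j
coprimeTo-periodic Q j = does-⇔ (mk⇔ shift coprime-+) (coprime? (Q + j) Q) (coprime? j Q)
  where
  shift : Coprime (Q + j) Q → Coprime j Q
  shift coprime (i∣j , i∣Q) = coprime (∣m∣n⇒∣m+n i∣Q i∣j , i∣Q)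

coprimeTo-multiple : ∀ {p Q} j → Prime p → p ∤ Q → coprimeTo Q (p * j) ≡ coprimeTo Q j
coprimeTo-multiple {p} {Q} j pr p∤Q = does-⇔ (mk⇔ drop-p add-p) (coprime? (p * j) Q) (coprime? j Q)
  where
  drop-p : Coprime (p * j) Q → Coprime j Q
  drop-p coprime (i∣j , i∣Q) = coprime (∣-trans i∣j (n∣m*n p) , i∣Q)
  add-p : Coprime j Q → Coprime (p * j) Q
  add-p coprime (i∣pj , i∣Q) = coprime (coprime-divisor (∣∤prime⇒coprime pr p∤Q i∣Q) i∣pj , i∣Q)

coprimeTo-prime-* : ∀ {p} Q k → Prime p → not (does (p ∣? k)) ∧ coprimeTo Q k ≡ coprimeTo (p * Q) k
coprimeTo-prime-* {p} Q k pr with p ∣? k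
... | yes p∣k = sym (dec-false (coprime? k (p * Q)) (λ coprime → prime≢1 pr (coprime (p∣k , m∣m*n Q))))
... | no p∤k  = does-⇔ (mk⇔ add-p drop-p) (coprime? k Q) (coprime? k (p * Q))
  where
  add-p : Coprime k Q → Coprime k (p * Q)
  add-p coprime (i∣k , i∣pQ) = coprime (i∣k , coprime-divisor (∣∤prime⇒coprime pr p∤k i∣k) i∣pQ)
  drop-p : Coprime k (p * Q) → Coprime k Q
  drop-p coprime (i∣k , i∣Q) = coprime (i∣k , ∣-trans i∣Q (n∣m*n p))

-- Count the residues up to p Q coprime to Q in two ways: by periodicity they
-- number p φ(Q); the multiples of p among them number φ(Q), the rest φ(p Q).
φ[p*Q]+φ[Q]≡p*φ[Q] : ∀ {p Q} → Prime p → p ∤ Q → φ (p * Q) + φ Q ≡ p * φ Q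
φ[p*Q]+φ[Q]≡p*φ[Q] {p} {Q} pr p∤Q = begin
  φ (p * Q) + φ Q                                  ≡⟨ +-comm (φ (p * Q)) (φ Q) ⟩
  φ Q + φ (p * Q)                                  ≡⟨ cong₂ _+_ (sym multiples) (sym non-multiples) ⟩
  count (λ k → does (p ∣? k) ∧ P k) (p * Q)
    + count (λ k → not (does (p ∣? k)) ∧ P k) (p * Q) ≡⟨ sym (count-split (λ k → does (p ∣? k)) P (p * Q)) ⟩
  count P (p * Q)                                  ≡⟨ count-*-periodic P Q (coprimeTo-periodic Q) p ⟩
  p * count P Q                                    ≡⟨ cong (p *_) (sym (φ≡count Q)) ⟩
  p * φ Q                                          ∎
  where
  open ≡-Reasoning
  instance
    p≢0 : NonZero p
    p≢0 = prime⇒nonZero pr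
  P : ℕ → Bool
  P = coprimeTo Q
  multiples : count (λ k → does (p ∣? k) ∧ P k) (p * Q) ≡ φ Q
  multiples = begin
    count (λ k → does (p ∣? k) ∧ P k) (p * Q) ≡⟨ count-multiples p P Q ⟩
    count (λ j → P (p * j)) Q                ≡⟨ count-cong (λ j → coprimeTo-multiple j pr p∤Q) Q ⟩
    count P Q                                ≡⟨ sym (φ≡count Q) ⟩
    φ Q                                      ∎
  non-multiples : count (λ k → not (does (p ∣? k)) ∧ P k) (p * Q) ≡ φ (p * Q)
  non-multiples = trans (count-cong (λ k → coprimeTo-prime-* Q k pr) (p * Q)) (sym (φ≡count (p * Q)))

p*Q∸φ[p*Q]≡p*[Q∸φQ]+φQ : ∀ {p Q} → Prime p → p ∤ Q → p * Q ∸ φ (p * Q) ≡ p * (Q ∸ φ Q) + φ Q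
p*Q∸φ[p*Q]≡p*[Q∸φQ]+φQ {p} {Q} pr p∤Q = begin
  p * Q ∸ φ (p * Q)                             ≡⟨ cong (_∸ φ (p * Q)) p*Q≡ ⟩
  (p * (Q ∸ φ Q) + φ Q) + φ (p * Q) ∸ φ (p * Q) ≡⟨ m+n∸n≡m (p * (Q ∸ φ Q) + φ Q) (φ (p * Q)) ⟩
  p * (Q ∸ φ Q) + φ Q                           ∎
  where
  open ≡-Reasoning
  p*Q≡ : p * Q ≡ (p * (Q ∸ φ Q) + φ Q) + φ (p * Q)
  p*Q≡ = begin
    p * Q                             ≡⟨ cong (p *_) (sym (m∸n+n≡m (φ≤ Q))) ⟩
    p * (Q ∸ φ Q + φ Q)               ≡⟨ *-distribˡ-+ p (Q ∸ φ Q) (φ Q) ⟩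
    p * (Q ∸ φ Q) + p * φ Q           ≡⟨ cong (p * (Q ∸ φ Q) +_) (sym (φ[p*Q]+φ[Q]≡p*φ[Q] pr p∤Q)) ⟩
    p * (Q ∸ φ Q) + (φ (p * Q) + φ Q) ≡⟨ cong (p * (Q ∸ φ Q) +_) (+-comm (φ (p * Q)) (φ Q)) ⟩
    p * (Q ∸ φ Q) + (φ Q + φ (p * Q)) ≡⟨ sym (+-assoc (p * (Q ∸ φ Q)) (φ Q) (φ (p * Q))) ⟩
    (p * (Q ∸ φ Q) + φ Q) + φ (p * Q) ∎

p*Q∸φ[p*Q]-monoˡ-< : ∀ {p q Q} → Prime p → Prime q → p ∤ Q → q ∤ Q → 2 ≤ Q → p < q →
  p * Q ∸ φ (p * Q) < q * Q ∸ φ (q * Q)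
p*Q∸φ[p*Q]-monoˡ-< {Q = Q} pp pq p∤Q q∤Q 2≤Q p<q =
  subst₂ _<_ (sym (p*Q∸φ[p*Q]≡p*[Q∸φQ]+φQ pp p∤Q)) (sym (p*Q∸φ[p*Q]≡p*[Q∸φQ]+φQ pq q∤Q))
    (+-monoˡ-< (φ Q) (*-monoˡ-< (Q ∸ φ Q) {{>-nonZero (m<n⇒0<n∸m (φ< 2≤Q))}} p<q))

omit : ∀ {r} → (Fin r → ℕ) → Fin r → Fin r → ℕ
omit f c i = if does (i ≟ᶠ c) then 1 else f i

omit-≢ : ∀ {r} (f : Fin r → ℕ) {c i} → i ≢ c → omit f c i ≡ f i
omit-≢ f {c} {i} i≢c = cong (if_then 1 else f i) (dec-false (i ≟ᶠ c) i≢c)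

omit-comm : ∀ {r} (f : Fin r → ℕ) a b i → omit (omit f a) b i ≡ omit (omit f b) a i
omit-comm f a b i with i ≟ᶠ a | i ≟ᶠ b
... | yes _ | yes _ = refl
... | yes _ | no _  = refl
... | no _  | yes _ = refl
... | no _  | no _  = refl

omit-≥1 : ∀ {r} {f : Fin r → ℕ} → (∀ i → 1 ≤ f i) → ∀ c i → 1 ≤ omit f c i
omit-≥1 f≥1 c i with i ≟ᶠ c
... | yes _ = ≤-refl
... | no _  = f≥1 i

∏-cong : ∀ {r} {f g : Fin r → ℕ} → (∀ i → f i ≡ g i) → ∏ f ≡ ∏ g
∏-cong {zero}  f≗g = refl
∏-cong {suc r} f≗g = cong₂ _*_ (f≗g fzero) (∏-cong (λ i → f≗g (fsuc i)))

∏-omit : ∀ {r} (f : Fin r → ℕ) c → ∏ f ≡ f c * ∏ (omit f c)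
∏-omit f fzero    = cong (f fzero *_) (sym (*-identityˡ _))
∏-omit f (fsuc c) =
  trans (cong (f fzero *_) (∏-omit (λ i → f (fsuc i)) c)) (x*[y*z]≡y*[x*z] (f fzero) (f (fsuc c)) _)
  where
  x*[y*z]≡y*[x*z] : ∀ x y z → x * (y * z) ≡ y * (x * z)
  x*[y*z]≡y*[x*z] = solve-∀

∏≥1 : ∀ {r} {f : Fin r → ℕ} → (∀ i → 1 ≤ f i) → 1 ≤ ∏ f
∏≥1 {zero}  f≥1 = ≤-refl
∏≥1 {suc r} f≥1 = *-mono-≤ (f≥1 fzero) (∏≥1 (λ i → f≥1 (fsuc i)))

∏≥2 : ∀ {r} {f : Fin r → ℕ} → (∀ i → 1 ≤ f i) → ∀ c → 2 ≤ f c → 2 ≤ ∏ f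
∏≥2 {f = f} f≥1 c 2≤fc = subst (2 ≤_) (sym (∏-omit f c)) (*-mono-≤ 2≤fc (∏≥1 (omit-≥1 f≥1 c)))

prime∤∏ : ∀ {r} {q} {f : Fin r → ℕ} → Prime q → (∀ i → q ∤ f i) → q ∤ ∏ f
prime∤∏ {zero}  pq q∤f q∣1 = prime≢1 pq (∣1⇒≡1 q∣1)
prime∤∏ {suc r} {f = f} pq q∤f q∣∏ with euclidsLemma (f fzero) (∏ (λ i → f (fsuc i))) pq q∣∏
... | inj₁ q∣f0 = q∤f fzero q∣f0
... | inj₂ q∣∏′ = prime∤∏ pq (λ i → q∤f (fsuc i)) q∣∏′

prime∤radExcept : ∀ {r} {p : Fin r → ℕ} → (∀ i → Prime (p i)) → Injective _≡_ _≡_ p →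
  ∀ c → p c ∤ radExcept p c
prime∤radExcept {p = p} prime injective c = prime∤∏ (prime c) p[c]∤omit
  where
  p[c]∤omit : ∀ i → p c ∤ omit p c i
  p[c]∤omit i with i ≟ᶠ c
  ... | yes _  = λ p[c]∣1 → prime≢1 (prime c) (∣1⇒≡1 p[c]∣1)
  ... | no i≢c = λ p[c]∣p[i] → i≢c (injective (sym (prime∣prime⇒≡ (prime c) (prime i) p[c]∣p[i])))

radExcept-omit : ∀ {r} (f : Fin r → ℕ) {a b} → b ≢ a → radExcept f a ≡ f b * ∏ (omit (omit f a) b)
radExcept-omit f {a} {b} b≢a = trans (∏-omit (omit f a) b) (cong (_* ∏ (omit (omit f a) b)) (omit-≢ f b≢a))

prime∤∏omit₂ : ∀ {r} {p : Fin r → ℕ} → (∀ i → Prime (p i)) → Injective _≡_ _≡_ p →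
  ∀ {a b} → b ≢ a → p a ∤ ∏ (omit (omit p a) b)
prime∤∏omit₂ {p = p} prime injective {a} {b} b≢a p[a]∣ =
  prime∤radExcept prime injective a (subst (p a ∣_) (sym (radExcept-omit p b≢a)) (∣-trans p[a]∣ (n∣m*n (p b))))

2≤∏omit₂ : ∀ {r} {p : Fin r → ℕ} → (∀ i → Prime (p i)) → ∀ {a b c} → c ≢ a → c ≢ b →
  2 ≤ ∏ (omit (omit p a) b)
2≤∏omit₂ {p = p} prime {a} {b} {c} c≢a c≢b =
  ∏≥2 (omit-≥1 (omit-≥1 (λ i → <⇒≤ (prime≥2 (prime i))) a) b) c
    (subst (2 ≤_) (sym (trans (omit-≢ (omit p a) c≢b) (omit-≢ p c≢a))) (prime≥2 (prime c)))

strictlyIncreasing⇒injective : ∀ {r} {f : Fin r → ℕ} →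
  (∀ i j → toℕ i < toℕ j → f i < f j) → Injective _≡_ _≡_ f
strictlyIncreasing⇒injective increasing {i} {j} fi≡fj with <-cmp (toℕ i) (toℕ j)
... | tri< i<j _ _ = ⊥-elim (<-irrefl fi≡fj (increasing i j i<j))
... | tri≈ _ i≡j _ = toℕ-injective i≡j
... | tri> _ _ j<i = ⊥-elim (<-irrefl (sym fi≡fj) (increasing j i j<i))

avoid-adjacent : ∀ {r} (a b : Fin (suc (suc (suc r)))) → toℕ b ≡ suc (toℕ a) →
  Σ (Fin (suc (suc (suc r)))) (λ c → c ≢ a × c ≢ b)
avoid-adjacent fzero    b b≡1 = fsuc (fsuc fzero) , (λ ()) , (λ c≡b → 2≢1 (trans (cong toℕ c≡b) b≡1))
  where
  2≢1 : 2 ≢ 1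
  2≢1 ()
avoid-adjacent (fsuc a) b b≡1+a = fzero , (λ ()) , (λ c≡b → 0≢1+n (trans (cong toℕ c≡b) b≡1+a))

corollary3p3 : (r : ℕ) → 3 ≤ r → (p e : Fin r → ℕ) →
    (∀ i → Prime (p i)) → (∀ i j → toℕ i < toℕ j → p i < p j) → (∀ i → 1 ≤ e i) →
    ∀ (a b : Fin r) → toℕ b ≡ suc (toℕ a) → β¹ p e b < β¹ p e a
corollary3p3 (suc (suc (suc r))) (s≤s (s≤s (s≤s z≤n))) p e prime increasing _ a b b≡1+a =
  +-monoʳ-< (φ (nOf p e)) (*-monoʳ-< (nOverRad p e) {{nOverRad≢0}} bracket<)
  where
  injective : Injective _≡_ _≡_ p
  injective = strictlyIncreasing⇒injective increasing
  Q : ℕ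
  Q = ∏ (omit (omit p a) b)
  b≢a : b ≢ a
  b≢a b≡a = 1+n≢n (trans (sym b≡1+a) (cong toℕ b≡a))
  a≢b : a ≢ b
  a≢b a≡b = b≢a (sym a≡b)
  radExcept[a] : radExcept p a ≡ p b * Q
  radExcept[a] = radExcept-omit p b≢a
  radExcept[b] : radExcept p b ≡ p a * Q
  radExcept[b] = trans (radExcept-omit p a≢b) (cong (p a *_) (∏-cong (omit-comm p b a)))
  p[b]∤Q : p b ∤ Q
  p[b]∤Q = subst (p b ∤_) (∏-cong (omit-comm p b a)) (prime∤∏omit₂ prime injective a≢b)
  2≤Q : 2 ≤ Q
  2≤Q with avoid-adjacent a b b≡1+a
  ... | c , c≢a , c≢b = 2≤∏omit₂ prime c≢a c≢b
  bracket< : radExcept p b ∸ φ (radExcept p b) < radExcept p a ∸ φ (radExcept p a)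
  bracket< = subst₂ (λ x y → x ∸ φ x < y ∸ φ y) (sym radExcept[b]) (sym radExcept[a])
    (p*Q∸φ[p*Q]-monoˡ-< (prime a) (prime b) (prime∤∏omit₂ prime injective b≢a) p[b]∤Q 2≤Q
      (increasing a b (≤-reflexive (sym b≡1+a))))
  nOverRad≢0 : NonZero (nOverRad p e)
  nOverRad≢0 = >-nonZero (∏≥1 (λ i → m^n>0 (p i) {{prime⇒nonZero (prime i)}} (e i ∸ 1)))
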